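{- For every integer $n\ge 3$, the Mycielski graph $\mu(C_n)$ of the cycle $C_n$ is $1$-$11$-representable.
   Context: Words are finite sequences over a finite alphabet. For a word $w$ and letters $x,y$, let $w|_{\{x,y\}}$ be the subsequence of $w$ consisting of all occurrences of $x$ and $y$. For $k\ge 0$, a graph $G=(V,E)$ is $k$-$11$-representable if there is a word $w$ over the alphabet $V$ (each vertex occurring in $w$) such that for all distinct $x,y\in V$: the total number of occurrences of the factors $xx$ and $yy$ (i.e. pairs of consecutive equal letters) in $w|_{\{x,y\}}$ is at most $k$ if and only if $xy\in E$. For a graph $G=(V,E)$ with $V=\{v_1,\dots,v_n\}$, the Mycielski graph $\mu(G)$ has vertex set $V\cup\{u_1,\dots,u_n\}\cup\{x\}$ (all new, distinct vertices) and edge set $E$ together with the edges $xu_i$ for all $i$ and $yu_i$ for all $i$ and all $y\in V$ adjacent to $v_i$ in $G$. $C_n$ is the cycle on $n$ vertices. -}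

module Defs where

open import Data.Nat using (ℕ; zero; suc; _+_; _≤_; _%_)
open import Data.Fin using (Fin; toℕ)
open import Data.List using (List; []; _∷_; filter)
open import Data.List.Membership.Propositional using (_∈_)
open import Data.Sum using (_⊎_; inj₁; inj₂)
open import Data.Unit using (⊤; tt)
open import Data.Empty using (⊥)
open import Data.Product using (Σ; _×_)
open import Relation.Nullary using (¬_; yes; no)
open import Relation.Nullary.Decidable using (_⊎-dec_)
open import Relation.Binary.PropositionalEquality using (_≡_; _≢_)
open import Relation.Binary.Definitions using (DecidableEquality)
open import Function.Bundles using (_⇔_)

restrict : {V : Set} → DecidableEquality V → V → V → List V → List V
restrict _≟_ x y = filter (λ z → (z ≟ x) ⊎-dec (z ≟ y))

-- Number of positions i with w_i = w_{i+1} (occurrences of factors aa).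
-- Applied to w|_{x,y} this is the total number of occurrences of xx and yy.
equalAdjacent : {V : Set} → DecidableEquality V → List V → ℕ
equalAdjacent _≟_ [] = 0
equalAdjacent _≟_ (a ∷ r) = go a r
  where
  go : _ → List _ → ℕ
  go a [] = 0
  go a (b ∷ r) with a ≟ b
  ... | yes _ = suc (go b r)
  ... | no  _ = go b r

-- A graph with vertex set V (decidable equality) and adjacency relation E
-- is k-11-representable if some word over V containing every vertex
-- satisfies: for distinct x y, (#xx + #yy in w|_{x,y}) ≤ k iff x y adjacent.
-- (Finiteness of V follows from every vertex occurring in the finite word w.)
_-11-representable : ℕ → (V : Set) → DecidableEquality V → (V → V → Set) → Set
(k -11-representable) V _≟_ E =
  Σ (List V) λ w →
    ((v : V) → v ∈ w) ×
    ((x y : V) → x ≢ y →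
      (equalAdjacent _≟_ (restrict _≟_ x y w) ≤ k) ⇔ E x y)

CycleNext : (n : ℕ) → Fin n → Fin n → Set
CycleNext n i j = (toℕ j ≡ suc (toℕ i)) ⊎ ((suc (toℕ i) ≡ n) × (toℕ j ≡ 0))

CycleAdj : (n : ℕ) → Fin n → Fin n → Set
CycleAdj n i j = CycleNext n i j ⊎ CycleNext n j i

-- Mycielski graph vertices: inj₁ v = v_i, inj₂ (inj₁ i) = u_i, inj₂ (inj₂ tt) = x.
MycV : Set → Set
MycV V = V ⊎ (V ⊎ ⊤)

-- Edges of μ(G) (for a symmetric adjacency E of G):
--   v_a v_b iff E a b;  x u_i for all i;  y u_i (y ∈ V) iff E y v_i.
MycAdj : {V : Set} → (V → V → Set) → MycV V → MycV V → Set
MycAdj E (inj₁ a) (inj₁ b) = E a b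
MycAdj E (inj₁ a) (inj₂ (inj₁ i)) = E a i
MycAdj E (inj₂ (inj₁ i)) (inj₁ a) = E a i
MycAdj E (inj₂ (inj₁ _)) (inj₂ (inj₂ _)) = ⊤
MycAdj E (inj₂ (inj₂ _)) (inj₂ (inj₁ _)) = ⊤
MycAdj E (inj₁ _) (inj₂ (inj₂ _)) = ⊥
MycAdj E (inj₂ (inj₂ _)) (inj₁ _) = ⊥
MycAdj E (inj₂ (inj₁ _)) (inj₂ (inj₁ _)) = ⊥
MycAdj E (inj₂ (inj₂ _)) (inj₂ (inj₂ _)) = ⊥

module Submission where

-- With indices modulo n, the word is
--   x B₀ B₁ … B_{n-1} v_{n-1} v₀ v₁ … v_{n-2},   where B_i = u_i v_{i-1} v_{i+1} u_i.
-- Restricted to two letters it has at most six letters, and the number of equal neighbours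
-- is read off from how their occurrences interleave: x u_i u_i gives 1, x v_j v_j v_j and
-- u_i u_i u_k u_k give 2. The two block occurrences of v_j lie in the blocks of its cycle
-- neighbours, so u_i separates them, or separates the second from the tail occurrence,
-- exactly when i is a neighbour of j, leaving at most one repetition. For v_j and v_k the
-- seven possible relative orders of their six occurrences leave at most one repetition
-- precisely when j and k are adjacent on the cycle, and two otherwise.

open import Defs
open import Data.Bool using (Bool; true; false; if_then_else_)
import Data.Bool.Properties as Bool
open import Data.Fin as Fin using (Fin; zero; suc; toℕ; #_)
open import Data.Fin.Properties using (toℕ-fromℕ<; toℕ-injective; toℕ<n) renaming (_≟_ to _≟ᶠ_)
open import Data.List using (List; []; _∷_; _++_; filter; map; length; lookup; allFin)
open import Data.List.Properties using (map-cong; map-∘)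
open import Data.List.Membership.Propositional using (_∈_; _∉_)
open import Data.List.Membership.Propositional.Properties
  using (∈-map⁺; ∈-map⁻; ∈-++⁺ˡ; ∈-++⁺ʳ; ∈-++⁻; ∈-lookup; ∈-allFin)
open import Data.List.Relation.Binary.Permutation.Propositional using (_↭_; ↭-sym; ↭-swap; ↭-refl)
open import Data.List.Relation.Binary.Permutation.Propositional.Properties using (∈-resp-↭)
open import Data.List.Relation.Unary.All as All using (all?)
open import Data.List.Relation.Unary.Any as Any using (here; there; any?)
open import Data.List.Relation.Unary.Any.Properties using (lookup-index)
open import Data.Nat using (ℕ; zero; suc; _+_; _*_; _≤_; _<_; s≤s; z≤n; _<?_; _≟_)
open import Data.Nat.DivMod using (_mod_; _/_; _%_; m≡m%n+[m/n]*n; m%n<n; m<n⇒m%n≡m; m<n*o⇒m/o<n)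
open import Data.Nat.Properties
  using (≤-refl; ≤-reflexive; ≤-trans; ≤-antisym; ≤-pred; <-irrefl; <-trans; <-cmp; <⇒≤; ≤∧≢⇒<; ≮⇒≥;
         n≤1+n; n<1+n; 1+n≰n; suc-injective; m≤m+n; +-suc; +-identityʳ; +-comm; +-monoʳ-<; +-mono-≤-<;
         *-monoˡ-≤; m≤n⇒∃[o]m+o≡n; m+[n∸m]≡n; m<n+o⇒m∸n<o; module ≤-Reasoning)
open import Data.Product using (_×_; _,_; proj₁; proj₂)
import Data.Sum as Sum
open import Data.Sum using (_⊎_; inj₁; inj₂; [_,_])
open import Data.Sum.Properties using (≡-dec; inj₁-injective; inj₂-injective)
open import Data.Unit using (⊤; tt)
open import Data.Unit.Properties using () renaming (_≟_ to _≟ᵘ_)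
open import Function using (_∘_; Injective)
open import Function.Bundles using (_⇔_; mk⇔; Equivalence)
open import Function.Construct.Composition using (_⇔-∘_)
open import Function.Construct.Identity using (⇔-id)
open import Relation.Binary.Definitions using (DecidableEquality; Tri; tri<; tri≈; tri>)
open import Relation.Binary.PropositionalEquality
  using (_≡_; _≢_; refl; sym; trans; cong; cong₂; subst; module ≡-Reasoning)
open import Relation.Nullary using (¬_; yes; no; does; contradiction)
open import Relation.Nullary.Decidable using (does-⇔; True; toWitness; _⊎-dec_)
open import Relation.Unary using (Pred; Decidable)

interval : ℕ → ℕ → List ℕ
interval s zero = []
interval s (suc k) = s ∷ interval (suc s) k

∈-interval : ∀ {s k p} → s ≤ p → p < s + k → p ∈ interval s k
∈-interval {s} {zero} {p} s≤p p<s+0 = contradiction (≤-trans p<s+0 (subst (_≤ p) (sym (+-identityʳ s)) s≤p)) (<-irrefl refl)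
∈-interval {s} {suc k} {p} s≤p p<s+1+k with s ≟ p
... | yes refl = here refl
... | no s≢p = there (∈-interval (≤∧≢⇒< s≤p s≢p) (subst (p <_) (+-suc s k) p<s+1+k))

Ascending : ℕ → List ℕ → Set
Ascending s [] = ⊤
Ascending s (p ∷ ps) = s ≤ p × Ascending (suc p) ps

Ascending-≤ : ∀ {s ps p} → Ascending s ps → p ∈ ps → s ≤ p
Ascending-≤ {ps = _ ∷ _} (s≤p , _) (here refl) = s≤p
Ascending-≤ {ps = _ ∷ _} (s≤q , asc) (there p∈ps) = <⇒≤ (≤-trans (s≤s s≤q) (Ascending-≤ asc p∈ps))

Ascending-suc : ∀ {s ps} → Ascending s ps → s ∉ ps → Ascending (suc s) ps
Ascending-suc {ps = []} _ _ = tt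
Ascending-suc {ps = _ ∷ _} (s≤p , asc) s∉ps = ≤∧≢⇒< s≤p (s∉ps ∘ here) , asc

Ascending-head : ∀ {s p ps} → Ascending s (p ∷ ps) → s ∈ p ∷ ps → s ≡ p
Ascending-head _ (here s≡p) = s≡p
Ascending-head (s≤p , asc) (there s∈ps) = contradiction (≤-trans (s≤s s≤p) (Ascending-≤ asc s∈ps)) (<-irrefl refl)

module _ {q} {Q : Pred ℕ q} (Q? : Decidable Q) where

  filter-interval : ∀ s k ps → Ascending s ps →
    (∀ {p} → p ∈ ps → p < s + k × Q p) →
    (∀ {p} → s ≤ p → p < s + k → Q p → p ∈ ps) →
    filter Q? (interval s k) ≡ ps
  filter-interval s zero [] _ _ _ = refl
  filter-interval s zero (p ∷ _) (s≤p , _) sound _ =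
    contradiction (≤-trans (proj₁ (sound (here refl))) (subst (_≤ p) (sym (+-identityʳ s)) s≤p)) (<-irrefl refl)
  filter-interval s (suc k) ps asc sound complete with Q? s
  ... | no ¬Qs = filter-interval (suc s) k ps (Ascending-suc asc (¬Qs ∘ proj₂ ∘ sound))
        (λ {p} p∈ps → let p< , Qp = sound p∈ps in subst (p <_) (+-suc s k) p< , Qp)
        (λ {p} s<p p< Qp → complete (<⇒≤ s<p) (subst (p <_) (sym (+-suc s k)) p<) Qp)
  ... | yes Qs = accept ps asc sound complete
      (complete ≤-refl (subst (s <_) (sym (+-suc s k)) (s≤s (m≤m+n s k))) Qs)
    where
    accept : ∀ ps → Ascending s ps →
      (∀ {p} → p ∈ ps → p < s + suc k × Q p) →
      (∀ {p} → s ≤ p → p < s + suc k → Q p → p ∈ ps) →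
      s ∈ ps → s ∷ filter Q? (interval (suc s) k) ≡ ps
    accept (p ∷ ps) asc sound complete s∈ps with refl ← Ascending-head asc s∈ps =
      cong (s ∷_) (filter-interval (suc s) k ps (proj₂ asc)
        (λ {p} p∈ps → let p< , Qp = sound (there p∈ps) in subst (p <_) (+-suc s k) p< , Qp)
        (λ {p} s<p p< Qp → drop-head s<p (complete (<⇒≤ s<p) (subst (p <_) (sym (+-suc s k)) p<) Qp)))
      where
      drop-head : ∀ {p} → s < p → p ∈ s ∷ ps → p ∈ ps
      drop-head s<p (here refl) = contradiction s<p (<-irrefl refl)
      drop-head _ (there p∈ps) = p∈ps

filter-map : ∀ {A B : Set} {p} {P : Pred B p} (P? : Decidable P) (f : A → B) xs →
  filter P? (map f xs) ≡ map f (filter (P? ∘ f) xs)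
filter-map P? f [] = refl
filter-map P? f (x ∷ xs) with does (P? (f x))
... | true = cong (f x ∷_) (filter-map P? f xs)
... | false = filter-map P? f xs

restrict-comm : ∀ {V : Set} (_≟_ : DecidableEquality V) a b w → restrict _≟_ a b w ≡ restrict _≟_ b a w
restrict-comm _≟_ a b [] = refl
restrict-comm _≟_ a b (z ∷ w) with z ≟ a | z ≟ b
... | yes _ | yes _ = cong (z ∷_) (restrict-comm _≟_ a b w)
... | yes _ | no _ = cong (z ∷_) (restrict-comm _≟_ a b w)
... | no _ | yes _ = cong (z ∷_) (restrict-comm _≟_ a b w)
... | no _ | no _ = restrict-comm _≟_ a b w

equalAdjacent-∷∷ : ∀ {A : Set} (_≟_ : DecidableEquality A) a b w →
  equalAdjacent _≟_ (a ∷ b ∷ w) ≡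
  (if does (a ≟ b) then suc (equalAdjacent _≟_ (b ∷ w)) else equalAdjacent _≟_ (b ∷ w))
equalAdjacent-∷∷ _≟_ a b w with a ≟ b
... | yes _ = refl
... | no _ = refl

equalAdjacent-map : ∀ {A B : Set} (_≟ᴬ_ : DecidableEquality A) (_≟ᴮ_ : DecidableEquality B) {f : A → B} →
  Injective _≡_ _≡_ f → ∀ w → equalAdjacent _≟ᴮ_ (map f w) ≡ equalAdjacent _≟ᴬ_ w
equalAdjacent-map _ _ _ [] = refl
equalAdjacent-map _ _ _ (a ∷ []) = refl
equalAdjacent-map _≟ᴬ_ _≟ᴮ_ {f} f-inj (a ∷ b ∷ w) = begin
  equalAdjacent _≟ᴮ_ (f a ∷ f b ∷ map f w)
    ≡⟨ equalAdjacent-∷∷ _≟ᴮ_ (f a) (f b) (map f w) ⟩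
  (if does (f a ≟ᴮ f b) then suc (equalAdjacent _≟ᴮ_ (map f (b ∷ w))) else equalAdjacent _≟ᴮ_ (map f (b ∷ w)))
    ≡⟨ cong₂ (λ d c → if d then suc c else c)
         (does-⇔ (mk⇔ f-inj (cong f)) (f a ≟ᴮ f b) (a ≟ᴬ b))
         (equalAdjacent-map _≟ᴬ_ _≟ᴮ_ f-inj (b ∷ w)) ⟩
  (if does (a ≟ᴬ b) then suc (equalAdjacent _≟ᴬ_ (b ∷ w)) else equalAdjacent _≟ᴬ_ (b ∷ w))
    ≡⟨ equalAdjacent-∷∷ _≟ᴬ_ a b w ⟨
  equalAdjacent _≟ᴬ_ (a ∷ b ∷ w) ∎
  where open ≡-Reasoning

≤1⇔-holds : ∀ {c k} {A : Set} → c ≡ k → k ≤ 1 → A → (c ≤ 1 ⇔ A)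
≤1⇔-holds refl k≤1 a = mk⇔ (λ _ → a) (λ _ → k≤1)

≤1⇔-fails : ∀ {c k} {A : Set} → c ≡ k → 2 ≤ k → ¬ A → (c ≤ 1 ⇔ A)
≤1⇔-fails refl 2≤k ¬a = mk⇔ (λ k≤1 → contradiction (≤-trans 2≤k k≤1) λ { (s≤s ()) }) (λ a → contradiction a ¬a)

enumerates : ∀ {k} (ns : List (Fin k)) → {True (all? (λ t → any? (t Fin.≟_) ns) (allFin k))} → ∀ t → t ∈ ns
enumerates ns {ok} t = All.lookup (toWitness ok) (∈-allFin t)

module Occurrences {A : Set} (_≟_ : DecidableEquality A) (letter : ℕ → A) (L : ℕ) where

  word : List A
  word = map letter (interval 0 L)

  count : A → A → ℕ
  count a b = equalAdjacent _≟_ (restrict _≟_ a b word)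

  count-comm : ∀ a b → count a b ≡ count b a
  count-comm a b = cong (equalAdjacent _≟_) (restrict-comm _≟_ a b word)

  record PositionsOf (a : A) (ps : List ℕ) : Set where
    field
      sound : ∀ {p} → p ∈ ps → p < L × letter p ≡ a
      complete : ∀ {p} → p < L → letter p ≡ a → p ∈ ps

  PositionsOf-↭ : ∀ {a ps qs} → ps ↭ qs → PositionsOf a ps → PositionsOf a qs
  PositionsOf-↭ ps↭qs posA = record
    { sound = PositionsOf.sound posA ∘ ∈-resp-↭ (↭-sym ps↭qs)
    ; complete = λ p<L eq → ∈-resp-↭ ps↭qs (PositionsOf.complete posA p<L eq) }

  PositionsOf⇒∈word : ∀ {a p ps} → PositionsOf a (p ∷ ps) → a ∈ word
  PositionsOf⇒∈word posA with p<L , eq ← PositionsOf.sound posA (here refl) =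
    subst (_∈ word) eq (∈-map⁺ letter (∈-interval z≤n p<L))

  tagged : List ℕ → List ℕ → List (ℕ × Bool)
  tagged ps qs = map (_, true) ps ++ map (_, false) qs

  label : A → A → Bool → A
  label a b true = a
  label a b false = b

  label-injective : ∀ {a b} → a ≢ b → Injective _≡_ _≡_ (label a b)
  label-injective _ {true} {true} _ = refl
  label-injective a≢b {true} {false} a≡b = contradiction a≡b a≢b
  label-injective a≢b {false} {true} b≡a = contradiction (sym b≡a) a≢b
  label-injective _ {false} {false} _ = refl

  -- The merge of the two position lists is given by indices into tagged ps qs: that it
  -- lists every entry is then decided by evaluation (enumerates), and only its being
  -- ascending needs a proof about the (symbolic) positions.
  count-merge : ∀ {a b ps qs} → a ≢ b → PositionsOf a ps → PositionsOf b qs →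
    (ns : List (Fin (length (tagged ps qs)))) → (∀ t → t ∈ ns) →
    Ascending 0 (map (proj₁ ∘ lookup (tagged ps qs)) ns) →
    count a b ≡ equalAdjacent Bool._≟_ (map (proj₂ ∘ lookup (tagged ps qs)) ns)
  count-merge {a} {b} {ps} {qs} a≢b posA posB ns all∈ns asc = begin
    equalAdjacent _≟_ (restrict _≟_ a b word)
      ≡⟨ cong (equalAdjacent _≟_) restricted ⟩
    equalAdjacent _≟_ (map (label a b) (map tag ns))
      ≡⟨ equalAdjacent-map Bool._≟_ _≟_ (label-injective a≢b) (map tag ns) ⟩
    equalAdjacent Bool._≟_ (map tag ns) ∎
    where
    open ≡-Reasoning
    open PositionsOf
    E = tagged ps qs
    pos = proj₁ ∘ lookup E
    tag = proj₂ ∘ lookup E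
    Q? = λ p → (letter p ≟ a) ⊎-dec (letter p ≟ b)

    entry-sound : ∀ {e} → e ∈ E → proj₁ e < L × letter (proj₁ e) ≡ label a b (proj₂ e)
    entry-sound e∈E with ∈-++⁻ (map (_, true) ps) e∈E
    ... | inj₁ e∈A with ∈-map⁻ (_, true) e∈A
    ...   | p , p∈ps , refl = sound posA p∈ps
    entry-sound e∈E | inj₂ e∈B with ∈-map⁻ (_, false) e∈B
    ...   | p , p∈qs , refl = sound posB p∈qs

    entry-listed : ∀ {e} → e ∈ E → proj₁ e ∈ map pos ns
    entry-listed {e} e∈E = subst (λ e′ → proj₁ e′ ∈ map pos ns) (sym (lookup-index e∈E)) (∈-map⁺ pos (all∈ns (Any.index e∈E)))

    listed-sound : ∀ {p} → p ∈ map pos ns → p < 0 + L × (letter p ≡ a ⊎ letter p ≡ b)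
    listed-sound p∈ with ∈-map⁻ pos p∈
    ... | t , _ , refl with lookup E t | entry-sound (∈-lookup {xs = E} t)
    ...   | (_ , true) | p<L , eq = p<L , inj₁ eq
    ...   | (_ , false) | p<L , eq = p<L , inj₂ eq

    listed-complete : ∀ {p} → 0 ≤ p → p < 0 + L → (letter p ≡ a ⊎ letter p ≡ b) → p ∈ map pos ns
    listed-complete _ p<L (inj₁ eq) = entry-listed (∈-++⁺ˡ (∈-map⁺ (_, true) (complete posA p<L eq)))
    listed-complete _ p<L (inj₂ eq) = entry-listed (∈-++⁺ʳ (map (_, true) ps) (∈-map⁺ (_, false) (complete posB p<L eq)))

    restricted : restrict _≟_ a b word ≡ map (label a b) (map tag ns)
    restricted = begin
      restrict _≟_ a b word                      ≡⟨ filter-map (λ z → (z ≟ a) ⊎-dec (z ≟ b)) letter (interval 0 L) ⟩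
      map letter (filter Q? (interval 0 L))      ≡⟨ cong (map letter) (filter-interval Q? 0 L (map pos ns) asc listed-sound listed-complete) ⟩
      map letter (map pos ns)                    ≡⟨ map-∘ ns ⟨
      map (letter ∘ pos) ns                      ≡⟨ map-cong (λ t → proj₂ (entry-sound (∈-lookup {xs = E} t))) ns ⟩
      map (label a b ∘ tag) ns                   ≡⟨ map-∘ ns ⟩
      map (label a b) (map tag ns)               ∎

module MycielskiCycleWord (m : ℕ) where

  N : ℕ
  N = suc (suc (suc m))

  Vertex : Set
  Vertex = MycV (Fin N)

  _≟ᵛ_ : DecidableEquality Vertex
  _≟ᵛ_ = ≡-dec _≟ᶠ_ (≡-dec _≟ᶠ_ _≟ᵘ_)

  fin : ℕ → Fin N
  fin i = i mod N

  toℕ-fin : ∀ {i} → i < N → toℕ (fin i) ≡ i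
  toℕ-fin {i} i<N = trans (toℕ-fromℕ< (m%n<n i N)) (m<n⇒m%n≡m i<N)

  fin-injective : ∀ {i j} → i < N → j < N → fin i ≡ fin j → i ≡ j
  fin-injective {i} {j} i<N j<N eq = trans (sym (toℕ-fin i<N)) (trans (cong toℕ eq) (toℕ-fin j<N))

  fin-toℕ : ∀ f → fin (toℕ f) ≡ f
  fin-toℕ f = toℕ-injective (toℕ-fin (toℕ<n f))

  v u : ℕ → Vertex
  v i = inj₁ (fin i)
  u i = inj₂ (inj₁ (fin i))

  x : Vertex
  x = inj₂ (inj₂ tt)

  v-injective : ∀ {i j} → i < N → j < N → v i ≡ v j → i ≡ j
  v-injective i<N j<N = fin-injective i<N j<N ∘ inj₁-injective

  u-injective : ∀ {i j} → i < N → j < N → u i ≡ u j → i ≡ j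
  u-injective i<N j<N = fin-injective i<N j<N ∘ inj₁-injective ∘ inj₂-injective

  next : ℕ → ℕ
  next i with suc i <? N
  ... | yes _ = suc i
  ... | no _ = 0

  prev : ℕ → ℕ
  prev zero = suc (suc m)
  prev (suc i) = i

  next-suc : ∀ {i} → suc i < N → next i ≡ suc i
  next-suc {i} 1+i<N with suc i <? N
  ... | yes _ = refl
  ... | no 1+i≮N = contradiction 1+i<N 1+i≮N

  next-last : next (suc (suc m)) ≡ 0
  next-last with suc (suc (suc m)) <? N
  ... | yes N<N = contradiction N<N (<-irrefl refl)
  ... | no _ = refl

  next-0 : next 0 ≡ 1
  next-0 = next-suc (s≤s (s≤s z≤n))

  next<N : ∀ i → next i < N
  next<N i with suc i <? N
  ... | yes 1+i<N = 1+i<N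
  ... | no _ = s≤s z≤n

  prev<N : ∀ {i} → i < N → prev i < N
  prev<N {zero} _ = ≤-refl
  prev<N {suc i} 1+i<N = <-trans (n<1+n i) 1+i<N

  prev-next : ∀ {i} → i < N → prev (next i) ≡ i
  prev-next {i} i<N with suc i <? N
  ... | yes _ = refl
  ... | no 1+i≮N = sym (suc-injective (≤-antisym i<N (≮⇒≥ 1+i≮N)))

  next-prev : ∀ {i} → i < N → next (prev i) ≡ i
  next-prev {zero} _ = next-last
  next-prev {suc i} 1+i<N = next-suc 1+i<N

  Neighbours : ℕ → ℕ → Set
  Neighbours j k = k ≡ next j ⊎ j ≡ next k

  next≡⇔CycleNext : ∀ (f g : Fin N) → (toℕ g ≡ next (toℕ f)) ⇔ CycleNext N f g
  next≡⇔CycleNext f g = mk⇔ to from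
    where
    to : toℕ g ≡ next (toℕ f) → CycleNext N f g
    to g≡ with suc (toℕ f) <? N
    ... | yes _ = inj₁ g≡
    ... | no 1+f≮N = inj₂ (≤-antisym (toℕ<n f) (≮⇒≥ 1+f≮N) , g≡)
    from : CycleNext N f g → toℕ g ≡ next (toℕ f)
    from (inj₁ g≡1+f) = trans g≡1+f (sym (next-suc (subst (_< N) g≡1+f (toℕ<n g))))
    from (inj₂ (1+f≡N , g≡0)) = trans g≡0 (sym (trans (cong next (suc-injective 1+f≡N)) next-last))

  Neighbours⇔CycleAdj : ∀ (f g : Fin N) → Neighbours (toℕ f) (toℕ g) ⇔ CycleAdj N f g
  Neighbours⇔CycleAdj f g = mk⇔
    (Sum.map (Equivalence.to (next≡⇔CycleNext f g)) (Equivalence.to (next≡⇔CycleNext g f)))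
    (Sum.map (Equivalence.from (next≡⇔CycleNext f g)) (Equivalence.from (next≡⇔CycleNext g f)))

  next-or-prev⇔Neighbours : ∀ {i j} → i < N → j < N → (i ≡ next j ⊎ i ≡ prev j) ⇔ Neighbours j i
  next-or-prev⇔Neighbours {i} {j} i<N j<N = mk⇔ (Sum.map₂ to) (Sum.map₂ from)
    where
    to : i ≡ prev j → j ≡ next i
    to i≡ = trans (sym (next-prev j<N)) (cong next (sym i≡))
    from : j ≡ next i → i ≡ prev j
    from j≡ = trans (sym (prev-next i<N)) (cong prev (sym j≡))

  block : ℕ → Fin 4 → Vertex
  block b zero = u b
  block b (suc zero) = v (prev b)
  block b (suc (suc zero)) = v (next b)
  block b (suc (suc (suc zero))) = u b

  -- suffix k i lists B_i … B_{i+k-1} v_{n-1} v₀ … v_{n-2} as a function of the position.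
  suffix : ℕ → ℕ → ℕ → Vertex
  suffix zero i t = v (prev t)
  suffix (suc k) i 0 = block i zero
  suffix (suc k) i 1 = block i (suc zero)
  suffix (suc k) i 2 = block i (suc (suc zero))
  suffix (suc k) i 3 = block i (suc (suc (suc zero)))
  suffix (suc k) i (suc (suc (suc (suc p)))) = suffix k (suc i) p

  letter : ℕ → Vertex
  letter zero = x
  letter (suc p) = suffix N 0 p

  suffix-+ : ∀ j k i p → suffix (j + k) i (j * 4 + p) ≡ suffix k (j + i) p
  suffix-+ zero k i p = refl
  suffix-+ (suc j) k i p = trans (suffix-+ j k (suc i) p) (cong (λ i′ → suffix k i′ p) (+-suc j i))

  suffix-block : ∀ k b s → suffix (suc k) b (toℕ s) ≡ block b s
  suffix-block k b zero = refl
  suffix-block k b (suc zero) = refl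
  suffix-block k b (suc (suc zero)) = refl
  suffix-block k b (suc (suc (suc zero))) = refl

  wordLength : ℕ
  wordLength = suc (N * 4 + N)

  -- Positions are opaque: apart from the letters found there, only their order is used.
  opaque
    blockPos : ℕ → Fin 4 → ℕ
    blockPos b s = suc (b * 4 + toℕ s)

    tailPos : ℕ → ℕ
    tailPos t = suc (N * 4 + t)

    letter-blockPos : ∀ {b} → b < N → ∀ s → letter (blockPos b s) ≡ block b s
    letter-blockPos {b} b<N s with k , 1+b+k≡N ← m≤n⇒∃[o]m+o≡n b<N = begin
      suffix N 0 (b * 4 + toℕ s)           ≡⟨ cong (λ n → suffix n 0 (b * 4 + toℕ s)) (trans (sym 1+b+k≡N) (sym (+-suc b k))) ⟩
      suffix (b + suc k) 0 (b * 4 + toℕ s) ≡⟨ suffix-+ b (suc k) 0 (toℕ s) ⟩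
      suffix (suc k) (b + 0) (toℕ s)       ≡⟨ cong (λ b′ → suffix (suc k) b′ (toℕ s)) (+-identityʳ b) ⟩
      suffix (suc k) b (toℕ s)             ≡⟨ suffix-block k b s ⟩
      block b s                            ∎
      where open ≡-Reasoning

    letter-tailPos : ∀ t → letter (tailPos t) ≡ v (prev t)
    letter-tailPos t = trans (cong (λ n → suffix n 0 (N * 4 + t)) (sym (+-identityʳ N))) (suffix-+ N 0 0 t)

    blockPos-<-later : ∀ {b c} (s : Fin 4) r → b < c → blockPos b s < suc (c * 4 + r)
    blockPos-<-later {b} {c} s r b<c = s≤s (begin-strict
      b * 4 + toℕ s  <⟨ +-monoʳ-< (b * 4) (toℕ<n s) ⟩
      b * 4 + 4      ≡⟨ +-comm (b * 4) 4 ⟩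
      suc b * 4      ≤⟨ *-monoˡ-≤ 4 b<c ⟩
      c * 4          ≤⟨ m≤m+n (c * 4) r ⟩
      c * 4 + r      ∎)
      where open ≤-Reasoning

    blockPos-<-slot : ∀ {b b′} {s s′ : Fin 4} → b ≤ b′ → toℕ s < toℕ s′ → blockPos b s < blockPos b′ s′
    blockPos-<-slot b≤b′ s<s′ = s≤s (+-mono-≤-< (*-monoˡ-≤ 4 b≤b′) s<s′)

    tailPos-< : ∀ {t t′} → t < t′ → tailPos t < tailPos t′
    tailPos-< t<t′ = s≤s (+-monoʳ-< (N * 4) t<t′)

    blockPos-<-block : ∀ {b b′} {s s′ : Fin 4} → b < b′ → blockPos b s < blockPos b′ s′
    blockPos-<-block {s = s} {s′} b<b′ = blockPos-<-later s (toℕ s′) b<b′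

    blockPos<tailPos : ∀ {b t} {s : Fin 4} → b < N → blockPos b s < tailPos t
    blockPos<tailPos {t = t} {s} b<N = blockPos-<-later s t b<N

    blockPos<wordLength : ∀ {b} → b < N → ∀ s → blockPos b s < wordLength
    blockPos<wordLength b<N s = blockPos-<-later s N b<N

    0<blockPos : ∀ {b s} → 0 < blockPos b s
    0<blockPos = s≤s z≤n

    tailPos<wordLength : ∀ {t} → t < N → tailPos t < wordLength
    tailPos<wordLength t<N = s≤s (+-monoʳ-< (N * 4) t<N)

  data Position : ℕ → Set where
    apexPos : Position 0
    inBlock : ∀ {b} → b < N → ∀ s → Position (blockPos b s)
    inTail : ∀ {t} → t < N → Position (tailPos t)

  opaque
    unfolding blockPos

    position : ∀ {p} → p < wordLength → Position p
    position {zero} _ = apexPos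
    position {suc q} (s≤s q<) with q <? N * 4
    ... | yes q<4N = subst Position (cong suc (sym q≡)) (inBlock (m<n*o⇒m/o<n q<4N) (q mod 4))
      where
      q≡ : q ≡ q / 4 * 4 + toℕ (q mod 4)
      q≡ = trans (m≡m%n+[m/n]*n q 4) (trans (+-comm (q % 4) _) (cong (q / 4 * 4 +_) (sym (toℕ-fromℕ< (m%n<n q 4)))))
    ... | no q≮4N = subst Position (cong suc (m+[n∸m]≡n (≮⇒≥ q≮4N))) (inTail (m<n+o⇒m∸n<o q (N * 4) q<))

  open Occurrences _≟ᵛ_ letter wordLength public

  vPositions : ℕ → ℕ → List ℕ
  vPositions a b = blockPos a (# 1) ∷ blockPos b (# 2) ∷ tailPos a ∷ []

  positions-x : PositionsOf x (0 ∷ [])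
  positions-x = record { sound = λ { (here refl) → s≤s z≤n , refl } ; complete = complete }
    where
    complete : ∀ {p} → p < wordLength → letter p ≡ x → p ∈ 0 ∷ []
    complete p<L eq with position p<L
    ... | apexPos = here refl
    ... | inBlock b<N zero with () ← trans (sym (letter-blockPos b<N _)) eq
    ... | inBlock b<N (suc zero) with () ← trans (sym (letter-blockPos b<N _)) eq
    ... | inBlock b<N (suc (suc zero)) with () ← trans (sym (letter-blockPos b<N _)) eq
    ... | inBlock b<N (suc (suc (suc zero))) with () ← trans (sym (letter-blockPos b<N _)) eq
    ... | inTail {t} _ with () ← trans (sym (letter-tailPos t)) eq

  positions-u : ∀ {i} → i < N → PositionsOf (u i) (blockPos i (# 0) ∷ blockPos i (# 3) ∷ [])
  positions-u {i} i<N = record { sound = sound ; complete = complete }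
    where
    sound : ∀ {p} → p ∈ blockPos i (# 0) ∷ blockPos i (# 3) ∷ [] → p < wordLength × letter p ≡ u i
    sound (here refl) = blockPos<wordLength i<N _ , letter-blockPos i<N _
    sound (there (here refl)) = blockPos<wordLength i<N _ , letter-blockPos i<N _
    complete : ∀ {p} → p < wordLength → letter p ≡ u i → p ∈ blockPos i (# 0) ∷ blockPos i (# 3) ∷ []
    complete p<L eq with position p<L
    ... | apexPos with () ← eq
    ... | inBlock b<N zero = here (cong (λ c → blockPos c (# 0)) (u-injective b<N i<N (trans (sym (letter-blockPos b<N _)) eq)))
    ... | inBlock b<N (suc zero) with () ← trans (sym (letter-blockPos b<N _)) eq
    ... | inBlock b<N (suc (suc zero)) with () ← trans (sym (letter-blockPos b<N _)) eq
    ... | inBlock b<N (suc (suc (suc zero))) =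
          there (here (cong (λ c → blockPos c (# 3)) (u-injective b<N i<N (trans (sym (letter-blockPos b<N _)) eq))))
    ... | inTail {t} _ with () ← trans (sym (letter-tailPos t)) eq

  positions-v : ∀ {j} → j < N → PositionsOf (v j) (vPositions (next j) (prev j))
  positions-v {j} j<N = record { sound = sound ; complete = complete }
    where
    sound : ∀ {p} → p ∈ vPositions (next j) (prev j) → p < wordLength × letter p ≡ v j
    sound (here refl) = blockPos<wordLength (next<N j) _ ,
                        trans (letter-blockPos (next<N j) _) (cong v (prev-next j<N))
    sound (there (here refl)) = blockPos<wordLength (prev<N j<N) _ ,
                                trans (letter-blockPos (prev<N j<N) _) (cong v (next-prev j<N))
    sound (there (there (here refl))) = tailPos<wordLength (next<N j) ,
                                        trans (letter-tailPos (next j)) (cong v (prev-next j<N))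
    complete : ∀ {p} → p < wordLength → letter p ≡ v j → p ∈ vPositions (next j) (prev j)
    complete p<L eq with position p<L
    ... | apexPos with () ← eq
    ... | inBlock b<N zero with () ← trans (sym (letter-blockPos b<N _)) eq
    ... | inBlock {b} b<N (suc zero) = here (cong (λ c → blockPos c (# 1))
          (trans (sym (next-prev b<N)) (cong next (v-injective (prev<N b<N) j<N (trans (sym (letter-blockPos b<N _)) eq)))))
    ... | inBlock {b} b<N (suc (suc zero)) = there (here (cong (λ c → blockPos c (# 2))
          (trans (sym (prev-next b<N)) (cong prev (v-injective (next<N b) j<N (trans (sym (letter-blockPos b<N _)) eq))))))
    ... | inBlock b<N (suc (suc (suc zero))) with () ← trans (sym (letter-blockPos b<N _)) eq
    ... | inTail {t} t<N = there (there (here (cong tailPos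
          (trans (sym (next-prev t<N)) (cong next (v-injective (prev<N t<N) j<N (trans (sym (letter-tailPos t)) eq)))))))

  positions-v′ : ∀ {j a b} → j < N → next j ≡ a → prev j ≡ b → PositionsOf (v j) (vPositions a b)
  positions-v′ j<N refl refl = positions-v j<N

  count-x-u : ∀ {i} → i < N → count x (u i) ≡ 1
  count-x-u i<N = count-merge (λ ()) positions-x (positions-u i<N)
    (# 0 ∷ # 1 ∷ # 2 ∷ []) (enumerates _)
    (z≤n , 0<blockPos , blockPos-<-slot ≤-refl (s≤s z≤n) , tt)

  count-u-u : ∀ {i i′} → i < i′ → i′ < N → count (u i) (u i′) ≡ 2
  count-u-u i<i′ i′<N = count-merge u≢u′ (positions-u i<N) (positions-u i′<N)
    (# 0 ∷ # 1 ∷ # 2 ∷ # 3 ∷ []) (enumerates _)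
    (z≤n , blockPos-<-slot ≤-refl (s≤s z≤n) , blockPos-<-block i<i′ , blockPos-<-slot ≤-refl (s≤s z≤n) , tt)
    where
    i<N = <-trans i<i′ i′<N
    u≢u′ = λ eq → <-irrefl (u-injective i<N i′<N eq) i<i′

  -- v j occurs in the blocks of its two neighbours; lo < hi orders these two blocks.
  record SortedVPositions (j : ℕ) : Set where
    field
      lo hi : ℕ
      slotLo slotHi : Fin 4
      lo<hi : lo < hi
      hi<N : hi < N
      0<slotLo : 0 < toℕ slotLo
      slotLo<3 : toℕ slotLo < 3
      0<slotHi : 0 < toℕ slotHi
      slotHi<3 : toℕ slotHi < 3
      tailIndex : ℕ
      positions : PositionsOf (v j) (blockPos lo slotLo ∷ blockPos hi slotHi ∷ tailPos tailIndex ∷ [])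
      neighbours : ∀ {i} → (i ≡ next j ⊎ i ≡ prev j) ⇔ (i ≡ lo ⊎ i ≡ hi)

  sortedVPositions : ∀ {j} → j < N → SortedVPositions j
  sortedVPositions {zero} 0<N = record
    { lo = 1 ; hi = suc (suc m) ; slotLo = # 1 ; slotHi = # 2
    ; lo<hi = s≤s (s≤s z≤n) ; hi<N = ≤-refl
    ; 0<slotLo = s≤s z≤n ; slotLo<3 = s≤s (s≤s z≤n) ; 0<slotHi = s≤s z≤n ; slotHi<3 = ≤-refl
    ; positions = positions-v′ 0<N next-0 refl
    ; neighbours = λ {i} → subst (λ c → (i ≡ c ⊎ i ≡ prev 0) ⇔ (i ≡ 1 ⊎ i ≡ prev 0)) (sym next-0) (⇔-id _) }
  sortedVPositions {suc j} 1+j<N with suc (suc j) <? N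
  ... | yes 2+j<N = record
    { lo = j ; hi = suc (suc j) ; slotLo = # 2 ; slotHi = # 1
    ; lo<hi = s≤s (n≤1+n j) ; hi<N = 2+j<N
    ; 0<slotLo = s≤s z≤n ; slotLo<3 = ≤-refl ; 0<slotHi = s≤s z≤n ; slotHi<3 = s≤s (s≤s z≤n)
    ; positions = PositionsOf-↭ (↭-swap _ _ ↭-refl) (positions-v′ 1+j<N (next-suc 2+j<N) refl)
    ; neighbours = λ {i} → subst (λ c → (i ≡ c ⊎ i ≡ j) ⇔ (i ≡ j ⊎ i ≡ suc (suc j))) (sym (next-suc 2+j<N)) (mk⇔ Sum.swap Sum.swap) }
  ... | no 2+j≮N = record
    { lo = 0 ; hi = j ; slotLo = # 1 ; slotHi = # 2
    ; lo<hi = 0<j ; hi<N = <-trans (n<1+n j) 1+j<N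
    ; 0<slotLo = s≤s z≤n ; slotLo<3 = s≤s (s≤s z≤n) ; 0<slotHi = s≤s z≤n ; slotHi<3 = ≤-refl
    ; positions = positions-v′ 1+j<N next≡0 refl
    ; neighbours = λ {i} → subst (λ c → (i ≡ c ⊎ i ≡ j) ⇔ (i ≡ 0 ⊎ i ≡ j)) (sym next≡0) (⇔-id _) }
    where
    2+j≡N : suc (suc j) ≡ N
    2+j≡N = ≤-antisym 1+j<N (≮⇒≥ 2+j≮N)
    next≡0 : next (suc j) ≡ 0
    next≡0 = trans (cong next (suc-injective 2+j≡N)) next-last
    0<j : 0 < j
    0<j = subst (0 <_) (sym (suc-injective (suc-injective 2+j≡N))) (s≤s z≤n)

  count-x-v : ∀ {j} → j < N → count x (v j) ≡ 2
  count-x-v j<N = count-merge (λ ()) positions-x positions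
    (# 0 ∷ # 1 ∷ # 2 ∷ # 3 ∷ []) (enumerates _)
    (z≤n , 0<blockPos , blockPos-<-block lo<hi , blockPos<tailPos hi<N , tt)
    where open SortedVPositions (sortedVPositions j<N)

  count-u-v : ∀ {i j} → i < N → j < N → count (u i) (v j) ≤ 1 ⇔ (i ≡ next j ⊎ i ≡ prev j)
  count-u-v {i} {j} i<N j<N = by-cases (<-cmp i lo) (<-cmp i hi)
    where
    open SortedVPositions (sortedVPositions j<N)
    open Equivalence (neighbours {i})
    merge = count-merge (λ ()) (positions-u i<N) positions
    by-cases : Tri (i < lo) (i ≡ lo) (lo < i) → Tri (i < hi) (i ≡ hi) (hi < i) →
      count (u i) (v j) ≤ 1 ⇔ (i ≡ next j ⊎ i ≡ prev j)
    by-cases (tri< i<lo _ _) _ = ≤1⇔-fails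
      (merge (# 0 ∷ # 1 ∷ # 2 ∷ # 3 ∷ # 4 ∷ []) (enumerates _)
        (z≤n , blockPos-<-slot ≤-refl (s≤s z≤n) , blockPos-<-block i<lo , blockPos-<-block lo<hi , blockPos<tailPos hi<N , tt))
      (s≤s (s≤s z≤n)) ([ (λ i≡lo → <-irrefl i≡lo i<lo) , (λ i≡hi → <-irrefl i≡hi (<-trans i<lo lo<hi)) ] ∘ to)
    by-cases (tri≈ _ i≡lo _) _ = ≤1⇔-holds
      (merge (# 0 ∷ # 2 ∷ # 1 ∷ # 3 ∷ # 4 ∷ []) (enumerates _)
        (z≤n , blockPos-<-slot (≤-reflexive i≡lo) 0<slotLo , blockPos-<-slot (≤-reflexive (sym i≡lo)) slotLo<3 ,
         blockPos-<-block (subst (_< hi) (sym i≡lo) lo<hi) , blockPos<tailPos hi<N , tt))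
      (s≤s z≤n) (from (inj₁ i≡lo))
    by-cases (tri> _ _ lo<i) (tri< i<hi _ _) = ≤1⇔-fails
      (merge (# 2 ∷ # 0 ∷ # 1 ∷ # 3 ∷ # 4 ∷ []) (enumerates _)
        (z≤n , blockPos-<-block lo<i , blockPos-<-slot ≤-refl (s≤s z≤n) , blockPos-<-block i<hi , blockPos<tailPos hi<N , tt))
      ≤-refl ([ (λ i≡lo → <-irrefl (sym i≡lo) lo<i) , (λ i≡hi → <-irrefl i≡hi i<hi) ] ∘ to)
    by-cases (tri> _ _ lo<i) (tri≈ _ i≡hi _) = ≤1⇔-holds
      (merge (# 2 ∷ # 0 ∷ # 3 ∷ # 1 ∷ # 4 ∷ []) (enumerates _)
        (z≤n , blockPos-<-block lo<i , blockPos-<-slot (≤-reflexive i≡hi) 0<slotHi ,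
         blockPos-<-slot (≤-reflexive (sym i≡hi)) slotHi<3 , blockPos<tailPos i<N , tt))
      z≤n (from (inj₂ i≡hi))
    by-cases (tri> _ _ lo<i) (tri> _ _ hi<i) = ≤1⇔-fails
      (merge (# 2 ∷ # 3 ∷ # 0 ∷ # 1 ∷ # 4 ∷ []) (enumerates _)
        (z≤n , blockPos-<-block lo<hi , blockPos-<-block hi<i , blockPos-<-slot ≤-refl (s≤s z≤n) , blockPos<tailPos i<N , tt))
      ≤-refl ([ (λ i≡lo → <-irrefl (sym i≡lo) lo<i) , (λ i≡hi → <-irrefl (sym i≡hi) hi<i) ] ∘ to)

  count-v-v-via : ∀ {j k a b c d} → j < k → k < N →
    next j ≡ a → prev j ≡ b → next k ≡ c → prev k ≡ d →
    (ns : List (Fin 6)) → (∀ t → t ∈ ns) →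
    Ascending 0 (map (proj₁ ∘ lookup (tagged (vPositions a b) (vPositions c d))) ns) →
    count (v j) (v k) ≡ equalAdjacent Bool._≟_ (map (proj₂ ∘ lookup (tagged (vPositions a b) (vPositions c d))) ns)
  count-v-v-via j<k k<N ea eb ec ed = count-merge (λ eq → <-irrefl (v-injective j<N k<N eq) j<k)
    (positions-v′ j<N ea eb) (positions-v′ k<N ec ed)
    where j<N = <-trans j<k k<N

  count-v₀-v₁ : count (v 0) (v 1) ≡ 1
  count-v₀-v₁ = count-v-v-via (s≤s z≤n) (s≤s (s≤s z≤n)) next-0 refl (next-suc (s≤s (s≤s (s≤s z≤n)))) refl
    (# 4 ∷ # 0 ∷ # 3 ∷ # 1 ∷ # 2 ∷ # 5 ∷ []) (enumerates _)
    (z≤n , blockPos-<-block (n<1+n 0) , blockPos-<-block (n<1+n 1) , blockPos-<-slot (s≤s (s≤s z≤n)) (n<1+n 1) ,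
     blockPos<tailPos ≤-refl , tailPos-< (n<1+n 1) , tt)

  count-v₀-v : ∀ {k} → k < m → count (v 0) (v (suc (suc k))) ≡ 2
  count-v₀-v k<m = count-v-v-via (s≤s z≤n) (<⇒≤ 3+k<N) next-0 refl (next-suc 3+k<N) refl
    (# 0 ∷ # 4 ∷ # 3 ∷ # 1 ∷ # 2 ∷ # 5 ∷ []) (enumerates _)
    (z≤n , blockPos-<-slot (s≤s z≤n) (n<1+n 1) , blockPos-<-block (s≤s (n≤1+n _)) , blockPos-<-slot (s≤s (s≤s k<m)) (n<1+n 1) ,
     blockPos<tailPos ≤-refl , tailPos-< (s≤s (s≤s z≤n)) , tt)
    where 3+k<N = s≤s (s≤s (s≤s k<m))

  count-v₀-vlast : count (v 0) (v (suc (suc m))) ≡ 0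
  count-v₀-vlast = count-v-v-via (s≤s z≤n) ≤-refl next-0 refl next-last refl
    (# 3 ∷ # 0 ∷ # 4 ∷ # 1 ∷ # 5 ∷ # 2 ∷ []) (enumerates _)
    (z≤n , blockPos-<-block (n<1+n 0) , blockPos-<-slot (s≤s z≤n) (n<1+n 1) , blockPos-<-block (n<1+n _) ,
     blockPos<tailPos ≤-refl , tailPos-< (n<1+n 0) , tt)

  count-v-vsuc : ∀ {j} → suc (suc (suc j)) < N → count (v (suc j)) (v (suc (suc j))) ≡ 0
  count-v-vsuc 3+j<N = count-v-v-via ≤-refl (<⇒≤ 3+j<N) (next-suc (<⇒≤ 3+j<N)) refl (next-suc 3+j<N) refl
    (# 1 ∷ # 4 ∷ # 0 ∷ # 3 ∷ # 2 ∷ # 5 ∷ []) (enumerates _)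
    (z≤n , blockPos-<-block (n<1+n _) , blockPos-<-block (n<1+n _) , blockPos-<-block (n<1+n _) ,
     blockPos<tailPos 3+j<N , tailPos-< (n<1+n _) , tt)

  count-v-v : ∀ {j k} → j < k → suc (suc (suc k)) < N → count (v (suc j)) (v (suc (suc k))) ≡ 2
  count-v-v j<k 3+k<N = count-v-v-via (s≤s (s≤s (<⇒≤ j<k))) (<⇒≤ 3+k<N) (next-suc 2+j<N) refl (next-suc 3+k<N) refl
    (# 1 ∷ # 0 ∷ # 4 ∷ # 3 ∷ # 2 ∷ # 5 ∷ []) (enumerates _)
    (z≤n , blockPos-<-block (s≤s (n≤1+n _)) , blockPos-<-slot (s≤s j<k) (n<1+n 1) , blockPos-<-block (s≤s (n≤1+n _)) ,
     blockPos<tailPos 3+k<N , tailPos-< (s≤s (s≤s (s≤s (<⇒≤ j<k)))) , tt)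
    where 2+j<N = <-trans (s≤s (s≤s j<k)) (<⇒≤ 3+k<N)

  count-vlast-1-vlast : count (v (suc m)) (v (suc (suc m))) ≡ 0
  count-vlast-1-vlast = count-v-v-via ≤-refl ≤-refl (next-suc ≤-refl) refl next-last refl
    (# 3 ∷ # 1 ∷ # 4 ∷ # 0 ∷ # 5 ∷ # 2 ∷ []) (enumerates _)
    (z≤n , blockPos-<-slot z≤n (n<1+n 1) , blockPos-<-block (n<1+n _) , blockPos-<-block (n<1+n _) ,
     blockPos<tailPos ≤-refl , tailPos-< (s≤s z≤n) , tt)

  count-v-vlast : ∀ {j} → j < m → count (v (suc j)) (v (suc (suc m))) ≡ 2
  count-v-vlast j<m = count-v-v-via (s≤s (s≤s (<⇒≤ j<m))) ≤-refl (next-suc 2+j<N) refl next-last refl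
    (# 3 ∷ # 1 ∷ # 0 ∷ # 4 ∷ # 5 ∷ # 2 ∷ []) (enumerates _)
    (z≤n , blockPos-<-slot z≤n (n<1+n 1) , blockPos-<-block (s≤s (n≤1+n _)) , blockPos-<-slot (s≤s j<m) (n<1+n 1) ,
     blockPos<tailPos (s≤s (n≤1+n _)) , tailPos-< (s≤s z≤n) , tt)
    where 2+j<N = s≤s (s≤s (<-trans j<m (n<1+n m)))

  count-v-v⇔ : ∀ {j k} → j < k → k < N → count (v j) (v k) ≤ 1 ⇔ Neighbours j k
  count-v-v⇔ {zero} {suc zero} _ _ = ≤1⇔-holds count-v₀-v₁ ≤-refl (inj₁ (sym next-0))
  count-v-v⇔ {zero} {suc (suc k)} _ 2+k<N with k <? m
  ... | yes k<m = ≤1⇔-fails (count-v₀-v k<m) ≤-refl not-neighbours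
    where
    not-neighbours : ¬ Neighbours 0 (suc (suc k))
    not-neighbours (inj₁ e) with () ← trans e next-0
    not-neighbours (inj₂ e) with () ← trans e (next-suc (s≤s (s≤s (s≤s k<m))))
  ... | no k≮m with refl ← ≤-antisym (≤-pred (≤-pred (≤-pred 2+k<N))) (≮⇒≥ k≮m) =
    ≤1⇔-holds count-v₀-vlast z≤n (inj₂ (sym next-last))
  count-v-v⇔ {suc j} {suc (suc k)} (s≤s (s≤s j≤k)) 2+k<N with k <? m
  ... | yes k<m with j ≟ k
  ...   | yes refl = ≤1⇔-holds (count-v-vsuc (s≤s (s≤s (s≤s k<m)))) z≤n (inj₁ (sym (next-suc 2+k<N)))
  ...   | no j≢k = ≤1⇔-fails (count-v-v (≤∧≢⇒< j≤k j≢k) (s≤s (s≤s (s≤s k<m)))) ≤-refl not-neighbours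
    where
    not-neighbours : ¬ Neighbours (suc j) (suc (suc k))
    not-neighbours (inj₁ e) = j≢k (sym (suc-injective (suc-injective
      (trans e (next-suc (s≤s (s≤s (s≤s (≤-trans j≤k (<⇒≤ k<m))))))))))
    not-neighbours (inj₂ e) = 1+n≰n (≤-trans (n≤1+n _) (subst (_≤ k) (suc-injective (trans e (next-suc (s≤s (s≤s (s≤s k<m)))))) j≤k))
  count-v-v⇔ {suc j} {suc (suc k)} (s≤s (s≤s j≤k)) 2+k<N | no k≮m
    with refl ← ≤-antisym (≤-pred (≤-pred (≤-pred 2+k<N))) (≮⇒≥ k≮m) | j ≟ k
  ... | yes refl = ≤1⇔-holds count-vlast-1-vlast z≤n (inj₁ (sym (next-suc ≤-refl)))
  ... | no j≢m = ≤1⇔-fails (count-v-vlast (≤∧≢⇒< j≤k j≢m)) ≤-refl not-neighbours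
    where
    not-neighbours : ¬ Neighbours (suc j) (suc (suc m))
    not-neighbours (inj₁ e) = j≢m (sym (suc-injective (suc-injective (trans e (next-suc (s≤s (s≤s (s≤s j≤k))))))))
    not-neighbours (inj₂ e) with () ← trans e next-last

  v-toℕ : ∀ f → v (toℕ f) ≡ inj₁ f
  v-toℕ f = cong inj₁ (fin-toℕ f)

  u-toℕ : ∀ f → u (toℕ f) ≡ inj₂ (inj₁ f)
  u-toℕ f = cong (inj₂ ∘ inj₁) (fin-toℕ f)

  count-x-inj₁ : ∀ f → count x (inj₁ f) ≡ 2
  count-x-inj₁ f = trans (cong (count x) (sym (v-toℕ f))) (count-x-v (toℕ<n f))

  count-x-inj₂ : ∀ f → count x (inj₂ (inj₁ f)) ≡ 1
  count-x-inj₂ f = trans (cong (count x) (sym (u-toℕ f))) (count-x-u (toℕ<n f))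

  count-inj₂-inj₂ : ∀ {f g} → toℕ f < toℕ g → count (inj₂ (inj₁ f)) (inj₂ (inj₁ g)) ≡ 2
  count-inj₂-inj₂ {f} {g} f<g = trans (sym (cong₂ count (u-toℕ f) (u-toℕ g))) (count-u-u f<g (toℕ<n g))

  count-inj₁-inj₁ : ∀ {f g} → toℕ f < toℕ g → count (inj₁ f) (inj₁ g) ≤ 1 ⇔ CycleAdj N f g
  count-inj₁-inj₁ {f} {g} f<g = subst (λ c → c ≤ 1 ⇔ CycleAdj N f g) (cong₂ count (v-toℕ f) (v-toℕ g))
    (Neighbours⇔CycleAdj f g ⇔-∘ count-v-v⇔ f<g (toℕ<n g))

  count-inj₂-inj₁ : ∀ g f → count (inj₂ (inj₁ g)) (inj₁ f) ≤ 1 ⇔ CycleAdj N f g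
  count-inj₂-inj₁ g f = subst (λ c → c ≤ 1 ⇔ CycleAdj N f g) (cong₂ count (u-toℕ g) (v-toℕ f))
    (Neighbours⇔CycleAdj f g ⇔-∘ (next-or-prev⇔Neighbours (toℕ<n g) (toℕ<n f) ⇔-∘ count-u-v (toℕ<n g) (toℕ<n f)))

  CycleAdj-sym : ∀ {f g} → CycleAdj N f g ⇔ CycleAdj N g f
  CycleAdj-sym = mk⇔ Sum.swap Sum.swap

  count-comm-≤1⇔ : ∀ a b {A : Set} → count a b ≤ 1 ⇔ A → count b a ≤ 1 ⇔ A
  count-comm-≤1⇔ a b = subst (λ c → c ≤ 1 ⇔ _) (count-comm a b)

  count≤1⇔MycAdj : ∀ a b → a ≢ b → count a b ≤ 1 ⇔ MycAdj (CycleAdj N) a b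
  count≤1⇔MycAdj (inj₁ f) (inj₁ g) a≢b with <-cmp (toℕ f) (toℕ g)
  ... | tri< f<g _ _ = count-inj₁-inj₁ f<g
  ... | tri≈ _ f≡g _ = contradiction (cong inj₁ (toℕ-injective f≡g)) a≢b
  ... | tri> _ _ g<f = CycleAdj-sym ⇔-∘ count-comm-≤1⇔ (inj₁ g) (inj₁ f) (count-inj₁-inj₁ g<f)
  count≤1⇔MycAdj (inj₁ f) (inj₂ (inj₁ g)) _ = count-comm-≤1⇔ (inj₂ (inj₁ g)) (inj₁ f) (count-inj₂-inj₁ g f)
  count≤1⇔MycAdj (inj₂ (inj₁ g)) (inj₁ f) _ = count-inj₂-inj₁ g f
  count≤1⇔MycAdj (inj₁ f) (inj₂ (inj₂ tt)) _ = count-comm-≤1⇔ x (inj₁ f) (≤1⇔-fails (count-x-inj₁ f) ≤-refl λ ())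
  count≤1⇔MycAdj (inj₂ (inj₂ tt)) (inj₁ f) _ = ≤1⇔-fails (count-x-inj₁ f) ≤-refl λ ()
  count≤1⇔MycAdj (inj₂ (inj₁ g)) (inj₂ (inj₂ tt)) _ = count-comm-≤1⇔ x (inj₂ (inj₁ g)) (≤1⇔-holds (count-x-inj₂ g) ≤-refl tt)
  count≤1⇔MycAdj (inj₂ (inj₂ tt)) (inj₂ (inj₁ g)) _ = ≤1⇔-holds (count-x-inj₂ g) ≤-refl tt
  count≤1⇔MycAdj (inj₂ (inj₂ tt)) (inj₂ (inj₂ tt)) a≢b = contradiction refl a≢b
  count≤1⇔MycAdj (inj₂ (inj₁ f)) (inj₂ (inj₁ g)) a≢b with <-cmp (toℕ f) (toℕ g)
  ... | tri< f<g _ _ = ≤1⇔-fails (count-inj₂-inj₂ f<g) ≤-refl λ ()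
  ... | tri≈ _ f≡g _ = contradiction (cong (inj₂ ∘ inj₁) (toℕ-injective f≡g)) a≢b
  ... | tri> _ _ g<f = count-comm-≤1⇔ (inj₂ (inj₁ g)) (inj₂ (inj₁ f)) (≤1⇔-fails (count-inj₂-inj₂ g<f) ≤-refl λ ())

  vertex∈word : ∀ a → a ∈ word
  vertex∈word (inj₁ f) = subst (_∈ word) (v-toℕ f) (PositionsOf⇒∈word (positions-v (toℕ<n f)))
  vertex∈word (inj₂ (inj₁ f)) = subst (_∈ word) (u-toℕ f) (PositionsOf⇒∈word (positions-u (toℕ<n f)))
  vertex∈word (inj₂ (inj₂ tt)) = PositionsOf⇒∈word positions-x

mainTheorem1 : (n : ℕ) → 3 ≤ n →
    (1 -11-representable) (MycV (Fin n))
    (≡-dec _≟ᶠ_ (≡-dec _≟ᶠ_ _≟ᵘ_)) (MycAdj (CycleAdj n))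
mainTheorem1 0 ()
mainTheorem1 1 (s≤s ())
mainTheorem1 2 (s≤s (s≤s ()))
mainTheorem1 (suc (suc (suc m))) _ = word , vertex∈word , count≤1⇔MycAdj
  where open MycielskiCycleWord m
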